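{- Let $k\ge1$ and let $\lambda$ be a $k$-bounded partition with residue table $R=(r_{ij})_{1\le i\le j\le k}$. Then there exists exactly one $i$ with $1\le i\le k$ such that $r_{j,i-1}>0$ for all $1\le j\le i-1$ and $r_{ij}<k-j$ for all $i\le j\le k-1$.
   Context: A partition is a weakly decreasing finite sequence of positive integers; $m_j(\lambda)$ is the number of parts equal to $j$; $\lambda$ is $k$-bounded if all parts are at most $k$. The residue table of $\lambda$ is the upper-triangular array $(r_{ij})_{1\le i\le j\le k}$ with $r_{ii}=m_i(\lambda)\bmod(k+1-i)$ and $r_{ij}=(m_j(\lambda)+r_{i,j-1})\bmod(k+1-j)$ for $i<j$. -}

module Defs where

open import Data.Nat using (ℕ; zero; suc; _+_; _∸_; _≤_; _<_; _≥_; _≟_)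
open import Data.Nat.DivMod using (_%_)
open import Data.List using (List; length; filter)
open import Data.List.Relation.Unary.All using (All)
open import Data.List.Relation.Unary.Linked using (Linked)
open import Data.Product using (_×_)

IsPartition : List ℕ → Set
IsPartition λ′ = Linked (λ a b → b ≤ a) λ′ × All (λ p → 1 ≤ p) λ′

KBounded : ℕ → List ℕ → Set
KBounded k λ′ = All (λ p → p ≤ k) λ′

mult : List ℕ → ℕ → ℕ
mult λ′ j = length (filter (_≟ j) λ′)

-- a mod n, total: for n = 0 returns a (never used in the statement,
-- where moduli k+1-j with j ≤ k are always ≥ 1).
_mod_ : ℕ → ℕ → ℕ
a mod zero = a
a mod suc n = a % suc n

-- resAux k λ i d = r_{i,i+d}
resAux : ℕ → List ℕ → ℕ → ℕ → ℕ
resAux k λ′ i zero = mult λ′ i mod (suc k ∸ i)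
resAux k λ′ i (suc d) =
  (mult λ′ (suc (i + d)) + resAux k λ′ i d) mod (suc k ∸ suc (i + d))

-- residue table entry r_{ij} (meaningful for 1 ≤ i ≤ j ≤ k)
res : ℕ → List ℕ → ℕ → ℕ → ℕ
res k λ′ i j = resAux k λ′ i (j ∸ i)

GoodIndex : ℕ → List ℕ → ℕ → Set
GoodIndex k λ′ i =
  (1 ≤ i × i ≤ k)
  × (∀ j → 1 ≤ j → j ≤ i ∸ 1 → 0 < res k λ′ j (i ∸ 1))
  × (∀ j → i ≤ j → j ≤ k ∸ 1 → res k λ′ i j < k ∸ j)

-- Extend row i of the residue table by zeros to the left of the diagonal; then every row
-- obeys r_{i,c} = (m_c + r_{i,c-1}) mod (k+1-c), and x ↦ (m_c + x) mod (k+1-c) is injective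
-- on all values of column c-1 except that its maximum k+1-c collides with 0.
-- Uniqueness: two good rows i < i′ both end in 0 at column k; walking back, neither ever
-- takes the maximal value, so they agree all the way to column i′-1, where row i′ is 0
-- and row i is positive by goodness of i′.
-- Existence: by induction on c, every non-maximal value of column c is taken by a row
-- that is good up to column c. A value coming from a maximal entry is the one coming
-- from 0, and a fresh row entering with 0 is either good itself or shares 0 with an
-- older row.
-- Only the multiplicities enter.
module Submission where

open import Defs
open import Data.Nat using (ℕ; zero; suc; _+_; _∸_; _≤_; _<_; _≥_; z≤n; s≤s; _≤?_; _<?_; _≟_; NonZero)
open import Data.Nat.Properties
open import Data.Nat.DivMod using (_%_; %-distribˡ-+; m%n%n≡m%n; [m+n]%n≡m%n; m<n⇒m%n≡m; m%n<n; m%n≤n; n%1≡0)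
open import Data.List using (List)
open import Data.Product using (Σ; _×_; _,_)
open import Data.Sum using (inj₁; inj₂)
open import Data.Empty using (⊥; ⊥-elim)
open import Relation.Nullary using (yes; no; _×-dec_; contradiction)
open import Relation.Binary.Definitions using (tri<; tri≈; tri>)
open import Relation.Binary.PropositionalEquality using (_≡_; refl; sym; trans; cong; subst; module ≡-Reasoning)

[m+n%d]%d≡[m+n]%d : ∀ m n d .{{_ : NonZero d}} → (m + n % d) % d ≡ (m + n) % d
[m+n%d]%d≡[m+n]%d m n d = begin
  (m + n % d) % d          ≡⟨ %-distribˡ-+ m (n % d) d ⟩
  (m % d + n % d % d) % d  ≡⟨ cong (λ t → (m % d + t) % d) (m%n%n≡m%n n d) ⟩
  (m % d + n % d) % d      ≡⟨ %-distribˡ-+ m n d ⟨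
  (m + n) % d              ∎
  where open ≡-Reasoning

[d∸m%d+[m+n]%d]%d≡n : ∀ m {n d} .{{_ : NonZero d}} → n < d → (d ∸ m % d + (m + n) % d) % d ≡ n
[d∸m%d+[m+n]%d]%d≡n m {n} {d} n<d = begin
  (d ∸ a + (m + n) % d) % d  ≡⟨ cong (λ t → (d ∸ a + t) % d) [m+n]%d≡[a+n]%d ⟩
  (d ∸ a + (a + n) % d) % d  ≡⟨ [m+n%d]%d≡[m+n]%d (d ∸ a) (a + n) d ⟩
  (d ∸ a + (a + n)) % d      ≡⟨ cong (_% d) (+-assoc (d ∸ a) a n) ⟨
  (d ∸ a + a + n) % d        ≡⟨ cong (λ t → (t + n) % d) (m∸n+n≡m (m%n≤n m d)) ⟩
  (d + n) % d                ≡⟨ cong (_% d) (+-comm d n) ⟩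
  (n + d) % d                ≡⟨ [m+n]%n≡m%n n d ⟩
  n % d                      ≡⟨ m<n⇒m%n≡m n<d ⟩
  n                          ∎
  where
  open ≡-Reasoning
  a = m % d
  [m+n]%d≡[a+n]%d : (m + n) % d ≡ (a + n) % d
  [m+n]%d≡[a+n]%d = begin
    (m + n) % d      ≡⟨ cong (_% d) (+-comm m n) ⟩
    (n + m) % d      ≡⟨ [m+n%d]%d≡[m+n]%d n m d ⟨
    (n + a) % d      ≡⟨ cong (_% d) (+-comm n a) ⟩
    (a + n) % d      ∎

[m+n]%d≡[m+o]%d⇒n≡o : ∀ m {n o d} .{{_ : NonZero d}} → n < d → o < d →
                       (m + n) % d ≡ (m + o) % d → n ≡ o
[m+n]%d≡[m+o]%d⇒n≡o m {n} {o} {d} n<d o<d eq = begin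
  n                              ≡⟨ [d∸m%d+[m+n]%d]%d≡n m n<d ⟨
  (d ∸ m % d + (m + n) % d) % d  ≡⟨ cong (λ t → (d ∸ m % d + t) % d) eq ⟩
  (d ∸ m % d + (m + o) % d) % d  ≡⟨ [d∸m%d+[m+n]%d]%d≡n m o<d ⟩
  o                              ∎
  where open ≡-Reasoning

-- Throughout, k = suc n.
module ResidueTable (n : ℕ) (λ′ : List ℕ) where

  -- cell i c is r_{i,c} for i ≤ c and 0 for c < i.
  cell : ℕ → ℕ → ℕ
  cell i zero = 0
  cell i (suc c) with i ≤? suc c
  ... | yes _ = (mult λ′ (suc c) + cell i c) mod (suc n ∸ c)
  ... | no _ = 0

  cell-before : ∀ {i c} → c < i → cell i c ≡ 0
  cell-before {i} {zero} _ = refl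
  cell-before {i} {suc c} c<i with i ≤? suc c
  ... | yes i≤c = contradiction c<i (≤⇒≯ i≤c)
  ... | no _ = refl

  cell-below-diagonal : ∀ c → cell (suc c) c ≡ 0
  cell-below-diagonal c = cell-before {suc c} {c} ≤-refl

  diagonal-nonmax : ∀ {c} → c ≤ n → cell (suc c) c < suc n ∸ c
  diagonal-nonmax {c} c≤n rewrite cell-below-diagonal c = m<n⇒0<n∸m (s≤s c≤n)

  cell-suc : ∀ {i c} → i ≤ suc c → cell i (suc c) ≡ (mult λ′ (suc c) + cell i c) mod (suc n ∸ c)
  cell-suc {i} {c} i≤1+c with i ≤? suc c
  ... | yes _ = refl
  ... | no i≰1+c = contradiction i≤1+c i≰1+c

  cell-step : ∀ {i c} → c ≤ n → i ≤ suc c →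
              cell i (suc c) ≡ (mult λ′ (suc c) + cell i c) % suc (n ∸ c)
  cell-step {i} {c} c≤n i≤1+c rewrite cell-suc i≤1+c | +-∸-assoc 1 c≤n = refl

  cell-≤ : ∀ i c → c ≤ suc n → cell i c ≤ suc n ∸ c
  cell-≤ i zero _ = z≤n
  cell-≤ i (suc c) (s≤s c≤n) with suc c <? i
  ... | yes c<i rewrite cell-before c<i = z≤n
  ... | no c≮i rewrite cell-step c≤n (≮⇒≥ c≮i) =
    ≤-pred (m%n<n (mult λ′ (suc c) + cell i c) (suc (n ∸ c)))

  cell-last : ∀ {i} → i ≤ suc n → cell i (suc n) ≡ 0
  cell-last {i} i≤1+n rewrite cell-step {i} {n} ≤-refl i≤1+n | n∸n≡0 n =
    n%1≡0 (mult λ′ (suc n) + cell i n)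

  resAux≡cell : ∀ i d → resAux (suc n) λ′ (suc i) d ≡ cell (suc i) (suc i + d)
  resAux≡cell i zero rewrite +-identityʳ i | cell-suc {suc i} {i} ≤-refl
    | cell-below-diagonal i | +-identityʳ (mult λ′ (suc i)) = refl
  resAux≡cell i (suc d)
    rewrite +-suc i d | cell-suc {suc i} {suc (i + d)} (s≤s (m≤n⇒m≤1+n (m≤m+n i d)))
          | resAux≡cell i d = refl

  res≡cell : ∀ {i j} → 1 ≤ i → i ≤ j → res (suc n) λ′ i j ≡ cell i j
  res≡cell {suc i} {j} _ i≤j =
    trans (resAux≡cell i (j ∸ suc i)) (cong (cell (suc i)) (m+[n∸m]≡n i≤j))

  cell-suc-cong : ∀ {i j c} → c ≤ n → i ≤ suc c → j ≤ suc c →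
                  cell i c ≡ cell j c → cell i (suc c) ≡ cell j (suc c)
  cell-suc-cong {i} {j} {c} c≤n i≤1+c j≤1+c eq
    rewrite cell-step c≤n i≤1+c | cell-step c≤n j≤1+c | eq = refl

  cell-suc-wrap : ∀ {i j c} → c ≤ n → i ≤ suc c → j ≤ suc c →
                  cell i c ≡ suc n ∸ c → cell j c ≡ 0 → cell i (suc c) ≡ cell j (suc c)
  cell-suc-wrap {i} {j} {c} c≤n i≤1+c j≤1+c i-max j-zero
    rewrite cell-step c≤n i≤1+c | cell-step c≤n j≤1+c | i-max | j-zero | +-∸-assoc 1 c≤n
          | +-identityʳ (mult λ′ (suc c)) = [m+n]%n≡m%n (mult λ′ (suc c)) (suc (n ∸ c))

  cell-suc-injective : ∀ {i j c} → c ≤ n → i ≤ suc c → j ≤ suc c →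
                       cell i c < suc n ∸ c → cell j c < suc n ∸ c →
                       cell i (suc c) ≡ cell j (suc c) → cell i c ≡ cell j c
  cell-suc-injective {i} {j} {c} c≤n i≤1+c j≤1+c i<max j<max eq
    rewrite +-∸-assoc 1 c≤n =
    [m+n]%d≡[m+o]%d⇒n≡o (mult λ′ (suc c)) i<max j<max
      (trans (sym (cell-step c≤n i≤1+c)) (trans eq (cell-step c≤n j≤1+c)))

  record GoodUpTo (j c : ℕ) : Set where
    field
      1≤j : 1 ≤ j
      j≤1+c : j ≤ suc c
      earlier-positive : ∀ j′ → 1 ≤ j′ → j′ ≤ j ∸ 1 → 0 < cell j′ (j ∸ 1)
      row-nonmax : ∀ c′ → j ≤ c′ → c′ ≤ c → cell j c′ < suc n ∸ c′
  open GoodUpTo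

  GoodIndex⇒GoodUpTo : ∀ {j} → GoodIndex (suc n) λ′ j → GoodUpTo j n
  GoodIndex⇒GoodUpTo ((1≤j , j≤k) , earlier , row) = record
    { 1≤j = 1≤j
    ; j≤1+c = j≤k
    ; earlier-positive = λ j′ 1≤j′ j′<j → subst (0 <_) (res≡cell 1≤j′ j′<j) (earlier j′ 1≤j′ j′<j)
    ; row-nonmax = λ c j≤c c≤n → subst (_< suc n ∸ c) (res≡cell 1≤j j≤c) (row c j≤c c≤n)
    }

  GoodUpTo⇒GoodIndex : ∀ {j} → GoodUpTo j n → GoodIndex (suc n) λ′ j
  GoodUpTo⇒GoodIndex g =
    (1≤j g , j≤1+c g) ,
    (λ j′ 1≤j′ j′<j → subst (0 <_) (sym (res≡cell 1≤j′ j′<j)) (earlier-positive g j′ 1≤j′ j′<j)) ,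
    (λ c j≤c c≤n → subst (_< suc n ∸ c) (sym (res≡cell (1≤j g) j≤c)) (row-nonmax g c j≤c c≤n))

  GoodUpTo-extend : ∀ {j c} → GoodUpTo j c → cell j (suc c) < suc n ∸ suc c → GoodUpTo j (suc c)
  GoodUpTo-extend {j} {c} g nonmax = record
    { 1≤j = 1≤j g
    ; j≤1+c = m≤n⇒m≤1+n (j≤1+c g)
    ; earlier-positive = earlier-positive g
    ; row-nonmax = row-nonmax′
    }
    where
    row-nonmax′ : ∀ c′ → j ≤ c′ → c′ ≤ suc c → cell j c′ < suc n ∸ c′
    row-nonmax′ c′ j≤c′ c′≤1+c with m≤n⇒m<n∨m≡n c′≤1+c
    ... | inj₁ c′<1+c = row-nonmax g c′ j≤c′ (≤-pred c′<1+c)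
    ... | inj₂ refl = nonmax

  good-nonmax : ∀ {j c} → GoodUpTo j n → c ≤ n → cell j c < suc n ∸ c
  good-nonmax {j} {c} g c≤n with j ≤? c
  ... | yes j≤c = row-nonmax g c j≤c c≤n
  ... | no j≰c rewrite cell-before (≰⇒> j≰c) = m<n⇒0<n∸m (s≤s c≤n)

  good-rows-agree-back : ∀ {i j p} → GoodUpTo i n → GoodUpTo j n → i ≤ suc p → j ≤ suc p →
                         ∀ c → p ≤ c → c ≤ suc n → cell i c ≡ cell j c → cell i p ≡ cell j p
  good-rows-agree-back gi gj i≤1+p j≤1+p zero z≤n _ eq = eq
  good-rows-agree-back {i} {j} {p} gi gj i≤1+p j≤1+p (suc c) p≤1+c (s≤s c≤n) eq
    with m≤n⇒m<n∨m≡n p≤1+c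
  ... | inj₂ refl = eq
  ... | inj₁ (s≤s p≤c) =
    good-rows-agree-back gi gj i≤1+p j≤1+p c p≤c (m≤n⇒m≤1+n c≤n)
      (cell-suc-injective c≤n (≤-trans i≤1+p (s≤s p≤c)) (≤-trans j≤1+p (s≤s p≤c))
        (good-nonmax gi c≤n) (good-nonmax gj c≤n) eq)

  good-not-before : ∀ {i p} → GoodUpTo i n → GoodUpTo (suc p) n → i ≤ p → ⊥
  good-not-before {i} {p} gi gp i≤p = <-irrefl (sym agree-at-p) (earlier-positive gp i (1≤j gi) i≤p)
    where
    agree-at-p : cell i p ≡ 0
    agree-at-p = trans
      (good-rows-agree-back gi gp (m≤n⇒m≤1+n i≤p) ≤-refl (suc n)
        (m≤n⇒m≤1+n (≤-pred (j≤1+c gp))) ≤-refl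
        (trans (cell-last (j≤1+c gi)) (sym (cell-last (j≤1+c gp)))))
      (cell-below-diagonal p)

  GoodUpTo-unique : ∀ {i j} → GoodUpTo i n → GoodUpTo j n → j ≡ i
  GoodUpTo-unique {i} {j} gi gj with <-cmp i j | 1≤j gi | 1≤j gj
  ... | tri< (s≤s i≤p) _ _ | _ | s≤s _ = ⊥-elim (good-not-before gi gj i≤p)
  ... | tri≈ _ i≡j _ | _ | _ = sym i≡j
  ... | tri> _ _ (s≤s j≤p) | s≤s _ | _ = ⊥-elim (good-not-before gj gi j≤p)

  Represented : ℕ → ℕ → Set
  Represented c v = Σ ℕ λ j → GoodUpTo j c × cell j c ≡ v

  NonmaxRepresented : ℕ → Set
  NonmaxRepresented c = ∀ i → 1 ≤ i → i ≤ suc c → cell i c < suc n ∸ c → Represented c (cell i c)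

  nonmaxRepresented-zero : NonmaxRepresented 0
  nonmaxRepresented-zero i _ _ _ = 1 , good-1 , refl
    where
    good-1 : GoodUpTo 1 0
    good-1 = record
      { 1≤j = ≤-refl
      ; j≤1+c = ≤-refl
      ; earlier-positive = λ _ 1≤j′ j′≤0 → contradiction (≤-trans 1≤j′ j′≤0) λ ()
      ; row-nonmax = λ _ 1≤c′ c′≤0 → contradiction (≤-trans 1≤c′ c′≤0) λ ()
      }

  represented-old-row : ∀ {c} → c < n → NonmaxRepresented c →
                        ∀ i → 1 ≤ i → i ≤ suc c → cell i (suc c) < suc n ∸ suc c →
                        Represented (suc c) (cell i (suc c))
  represented-old-row {c} c<n ih i 1≤i i≤1+c nonmax =
    let j , gj , next = same-next
    in j , GoodUpTo-extend gj (subst (_< n ∸ c) (sym next) nonmax) , next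
    where
    c≤n = <⇒≤ c<n
    same-next : Σ ℕ λ j → GoodUpTo j c × cell j (suc c) ≡ cell i (suc c)
    same-next with m≤n⇒m<n∨m≡n (cell-≤ i c (m≤n⇒m≤1+n c≤n))
    ... | inj₁ i-nonmax =
      let j , gj , eq = ih i 1≤i i≤1+c i-nonmax
      in j , gj , cell-suc-cong c≤n (j≤1+c gj) i≤1+c eq
    ... | inj₂ i-max =
      let j , gj , eq = ih (suc c) (s≤s z≤n) ≤-refl (diagonal-nonmax c≤n)
      in j , gj , sym (cell-suc-wrap c≤n i≤1+c (j≤1+c gj) i-max (trans eq (cell-below-diagonal c)))

  represented-new-row : ∀ {c} → c < n → NonmaxRepresented c →
                        Represented (suc c) (cell (suc (suc c)) (suc c))
  represented-new-row {c} c<n ih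
    with anyUpTo? (λ j → (1 ≤? j) ×-dec (cell j (suc c) ≟ 0)) (suc (suc c))
  ... | yes (j , s≤s j≤1+c , 1≤j , j-zero) =
    let j′ , gj′ , eq = represented-old-row c<n ih j 1≤j j≤1+c
                          (subst (_< n ∸ c) (sym j-zero) (m<n⇒0<n∸m c<n))
    in j′ , gj′ , trans eq (trans j-zero (sym (cell-below-diagonal (suc c))))
  ... | no none-zero = suc (suc c) , fresh , refl
    where
    fresh : GoodUpTo (suc (suc c)) (suc c)
    fresh = record
      { 1≤j = s≤s z≤n
      ; j≤1+c = ≤-refl
      ; earlier-positive = λ j′ 1≤j′ j′≤1+c →
          n≢0⇒n>0 λ j′-zero → none-zero (j′ , s≤s j′≤1+c , 1≤j′ , j′-zero)
      ; row-nonmax = λ _ 2+c≤c′ c′≤1+c → contradiction (≤-trans 2+c≤c′ c′≤1+c) (<-irrefl refl)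
      }

  nonmaxRepresented : ∀ c → c ≤ n → NonmaxRepresented c
  nonmaxRepresented zero _ = nonmaxRepresented-zero
  nonmaxRepresented (suc c) c<n i 1≤i i≤2+c nonmax with m≤n⇒m<n∨m≡n i≤2+c
  ... | inj₁ (s≤s i≤1+c) = represented-old-row c<n (nonmaxRepresented c (<⇒≤ c<n)) i 1≤i i≤1+c nonmax
  ... | inj₂ refl = represented-new-row c<n (nonmaxRepresented c (<⇒≤ c<n))

  good-exists : Σ ℕ λ j → GoodUpTo j n
  good-exists =
    let j , gj , _ = nonmaxRepresented n ≤-refl (suc n) (s≤s z≤n) ≤-refl (diagonal-nonmax ≤-refl)
    in j , gj

proposition8p11 : (k : ℕ) → k ≥ 1 → (λ′ : List ℕ) → IsPartition λ′ → KBounded k λ′ →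
    Σ ℕ (λ i → GoodIndex k λ′ i × ((i′ : ℕ) → GoodIndex k λ′ i′ → i′ ≡ i))
proposition8p11 (suc n) _ λ′ _ _ =
  let j , gj = good-exists
  in j , GoodUpTo⇒GoodIndex gj , λ i′ gi′ → GoodUpTo-unique gj (GoodIndex⇒GoodUpTo gi′)
  where open ResidueTable n λ′
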